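{- Consider an instance of \textsc{RAI} with machines $\mathcal{M}=\{0,1,\dots,m-1\}$ in their natural order, where each job $j$ is eligible exactly on the machines $\ell(j),\ell(j)+1,\dots,r(j)$. Let $\mathrm{OPT}$ be the optimal makespan and let $$L=\max\Big(\max_{j\in\mathcal{J}}p_j,\ \max_{0\le \ell\le r\le m-1}\frac{p(\mathcal{J}(\ell,r))}{r-\ell+1}\Big),$$ where $\mathcal{J}(\ell,r)=\{j\in\mathcal{J}:\ell\le \ell(j),\ r(j)\le r\}$ and $p(J)=\sum_{j\in J}p_j$. Run the following least flexible first heuristic: consider machines $i^*=0,1,\dots,m-1$ in order; while the machine $i^*$ currently has load at most $L$ and the set $J$ of not yet placed jobs eligible on $i^*$ is nonempty, place on $i^*$ a job $j\in J$ with minimal $r(j)$ (ties broken arbitrarily); then move on to the next machine. Then this heuristic places every job (on an eligible machine), and every machine receives a load of at most $L+\max_{j\in\mathcal{J}}p_j\le 2\,\mathrm{OPT}$.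
   Context: \textsc{RAI} (restricted assignment with interval restrictions): a set $\mathcal{J}$ of jobs with sizes $p_j\ge 0$ and a set $\mathcal{M}$ of machines in a total order, each job eligible on a set of consecutive machines; a schedule assigns each job to an eligible machine; the load of a machine is the total size of the jobs assigned to it; the makespan is the maximum load, and $\mathrm{OPT}$ is the minimum makespan over all schedules.
   Formalization: The job sizes $p_j$ take values in the nonnegative rationals, so $L$, the machine loads and $\mathrm{OPT}$ are rational too. -}

module Defs where

open import Data.Nat as ℕ using (ℕ; zero; suc; _∸_)
open import Data.Fin as F using (Fin; toℕ; _≟_)
open import Data.Bool using (Bool; true; false; if_then_else_; _∧_)
open import Data.Maybe using (Maybe; just; nothing)
open import Data.Integer using (+_)
open import Data.Rational using (ℚ; 0ℚ; _+_; _*_; _⊔_; _≤_; _<_; _/_)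
open import Data.Product using (Σ; _×_; ∃)
open import Data.Sum using (_⊎_)
open import Relation.Nullary using (¬_)
open import Relation.Nullary.Decidable using (⌊_⌋)
open import Relation.Binary.PropositionalEquality using (_≡_)

sumF : ∀ {k} → (Fin k → ℚ) → ℚ
sumF {zero} f = 0ℚ
sumF {suc k} f = f F.zero + sumF (λ x → f (F.suc x))

maxF : ∀ {k} → (Fin k → ℚ) → ℚ
maxF {zero} f = 0ℚ
maxF {suc k} f = f F.zero ⊔ maxF (λ x → f (F.suc x))

record RAI : Set where
  field
    m : ℕ
    n : ℕ
    p : Fin n → ℚ
    p≥0 : ∀ j → 0ℚ ≤ p j
    lft : Fin n → Fin m
    rgt : Fin n → Fin m
    lft≤rgt : ∀ j → lft j F.≤ rgt j

module _ (I : RAI) where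
  open RAI I

  Eligible : Fin n → Fin m → Set
  Eligible j i = (lft j F.≤ i) × (i F.≤ rgt j)

  -- partial assignments (nothing = job not yet placed)
  Assignment : Set
  Assignment = Fin n → Maybe (Fin m)

  isOn : Maybe (Fin m) → Fin m → Bool
  isOn nothing i = false
  isOn (just i') i = ⌊ i' ≟ i ⌋

  load : Assignment → Fin m → ℚ
  load a i = sumF (λ j → if isOn (a j) i then p j else 0ℚ)

  Schedule : Set
  Schedule = Σ (Fin n → Fin m) (λ σ → ∀ j → Eligible j (σ j))

  makespan : Schedule → ℚ
  makespan (σ Data.Product., _) = maxF (load (λ j → just (σ j)))

  IsOPT : ℚ → Set
  IsOPT v = (∃ λ (s : Schedule) → makespan s ≡ v) × (∀ (s : Schedule) → v ≤ makespan s)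

  pmax : ℚ
  pmax = maxF p

  pJ : Fin m → Fin m → ℚ
  pJ l r = sumF (λ j → if (toℕ l ℕ.≤ᵇ toℕ (lft j)) ∧ (toℕ (rgt j) ℕ.≤ᵇ toℕ r) then p j else 0ℚ)

  density : Fin m → Fin m → ℚ
  density l r = pJ l r * ((+ 1) / suc (toℕ r ∸ toℕ l))

  Lbound : ℚ
  Lbound = pmax ⊔ maxF (λ l → maxF (λ r → if toℕ l ℕ.≤ᵇ toℕ r then density l r else 0ℚ))

  update : Assignment → Fin n → Fin m → Assignment
  update a j i j' = if ⌊ j' ≟ j ⌋ then just i else a j'

  Avail : Assignment → Fin n → Fin m → Set
  Avail a j i = (a j ≡ nothing) × Eligible j i

  -- Reachable states of the least-flexible-first heuristic:
  -- LFF k a : the heuristic is currently at machine index k with partial assignment a.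
  -- Runs are nondeterministic (ties broken arbitrarily).
  data LFF : ℕ → Assignment → Set where
    start : LFF 0 (λ _ → nothing)
    place : ∀ {a} (i : Fin m) (j : Fin n) →
            LFF (toℕ i) a →
            load a i ≤ Lbound →
            Avail a j i →
            (∀ j' → Avail a j' i → rgt j F.≤ rgt j') →
            LFF (toℕ i) (update a j i)
    next  : ∀ {a} (i : Fin m) →
            LFF (toℕ i) a →
            (Lbound < load a i ⊎ (∀ j → ¬ Avail a j i)) →
            LFF (suc (toℕ i)) a

module Submission where

-- The heuristic preserves an invariant: placed jobs sit on eligible machines; every load stays
-- below L + pmax, since a job is only added to a machine of load at most L; every machine already
-- passed is overloaded (load > L) or has all its eligible jobs placed on it or earlier; and a job
-- eligible on the machine of a placed job j, with smaller right end than j, is placed no later.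
-- Suppose a job j₀ is unplaced at the end and let r = r(j₀). Machine r is overloaded and holds only
-- jobs ending by r. Grow an interval [l, r] of such machines leftwards until l = 0 or machine l - 1
-- has every eligible job ending by r placed on it or earlier. Then every job on [l, r] lies in
-- J(l, r), so p(J(l, r)) ≥ total load > (r - l + 1) L, against the definition of L. Finally pmax
-- and every density are lower bounds on the makespan of any schedule, so L + pmax ≤ 2 OPT.

open import Defs

open import Algebra.Bundles using (Ring)
open import Data.Bool using (Bool; true; false; if_then_else_; _∧_; T)
open import Data.Bool.Properties using (T-∧; T-≡; if-float)
open import Data.Empty using (⊥; ⊥-elim)
open import Data.Fin as F using (Fin; toℕ)
open import Data.Fin.Properties using (suc-injective; toℕ<n; toℕ-fromℕ<; toℕ-injective; any?)
open import Data.Integer using (+_)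
open import Data.Maybe using (Maybe; just; nothing)
open import Data.Maybe.Properties using (just-injective; ≡-dec)
open import Data.Nat as ℕ using (ℕ; zero; suc; _∸_; z≤n; s≤s; _<ᵇ_)
import Data.Nat.Properties as ℕ
open import Data.Nat.Coprimality as Coprime using (1-coprimeTo)
open import Data.Product using (_×_; _,_; ∃; proj₁; proj₂)
open import Data.Rational using (ℚ; 0ℚ; 1ℚ; _+_; _*_; _≤_; _<_; _/_; mkℚ)
open import Data.Rational.Properties
open import Data.Sum as Sum using (_⊎_; inj₁; inj₂)
open import Data.Unit using (tt)
open import Function using (_∘_; Equivalence)
open import Relation.Binary.PropositionalEquality
  using (_≡_; _≢_; refl; cong; cong₂; subst; ≡-≟-identity; ≢-≟-identity; module ≡-Reasoning)
  renaming (sym to ≡-sym; trans to ≡-trans)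
open import Relation.Nullary using (¬_; yes; no; contradiction)
open import Relation.Nullary.Decidable using (⌊_⌋; _×-dec_)

open import Algebra.Properties.Semiring.Sum (Ring.semiring +-*-ring)
  using (sum; sum-cong-≗; ∑-comm; ∑-distrib-+; sum-replicate-zero)

[1+_] : ℕ → ℚ
[1+ d ] = + suc d / 1

private
  [1+d]-normal : ∀ d → [1+ d ] ≡ mkℚ (+ suc d) 0 (Coprime.sym (1-coprimeTo (suc d)))
  [1+d]-normal d = normalize-coprime (Coprime.sym (1-coprimeTo (suc d)))

[1+]-suc : ∀ d → [1+ suc d ] ≡ 1ℚ + [1+ d ]
[1+]-suc d = ≡-trans (cong (λ e → + suc (suc e) / 1) (≡-sym (ℕ.*-identityʳ d)))
                     (cong (λ x → 1ℚ + x) (≡-sym ([1+d]-normal d)))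

[1+]*1/[1+] : ∀ d → [1+ d ] * (+ 1 / suc d) ≡ 1ℚ
[1+]*1/[1+] d rewrite [1+d]-normal d | normalize-coprime (1-coprimeTo (suc d)) =
  *-inverseʳ (mkℚ (+ suc d) 0 (Coprime.sym (1-coprimeTo (suc d))))

p*1/[1+d]≤q⇒p≤[1+d]*q : ∀ {p q} d → p * (+ 1 / suc d) ≤ q → p ≤ [1+ d ] * q
p*1/[1+d]≤q⇒p≤[1+d]*q {p} {q} d h = begin
  p                                ≡⟨ ≡-sym (*-identityʳ p) ⟩
  p * 1ℚ                           ≡⟨ cong (p *_) (≡-sym (≡-trans (*-comm _ [1+ d ]) ([1+]*1/[1+] d))) ⟩
  p * ((+ 1 / suc d) * [1+ d ])    ≡⟨ ≡-sym (*-assoc p _ _) ⟩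
  p * (+ 1 / suc d) * [1+ d ]      ≤⟨ *-monoʳ-≤-nonNeg [1+ d ] {{normalize-nonNeg (suc d) 1}} h ⟩
  q * [1+ d ]                      ≡⟨ *-comm q _ ⟩
  [1+ d ] * q                      ∎
  where open ≤-Reasoning

p≤[1+d]*q⇒p*1/[1+d]≤q : ∀ {p q} d → p ≤ [1+ d ] * q → p * (+ 1 / suc d) ≤ q
p≤[1+d]*q⇒p*1/[1+d]≤q {p} {q} d h = begin
  p * (+ 1 / suc d)                ≤⟨ *-monoʳ-≤-nonNeg (+ 1 / suc d) {{normalize-nonNeg 1 (suc d)}} h ⟩
  [1+ d ] * q * (+ 1 / suc d)      ≡⟨ cong (_* (+ 1 / suc d)) (*-comm [1+ d ] q) ⟩
  q * [1+ d ] * (+ 1 / suc d)      ≡⟨ *-assoc q _ _ ⟩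
  q * ([1+ d ] * (+ 1 / suc d))    ≡⟨ cong (q *_) ([1+]*1/[1+] d) ⟩
  q * 1ℚ                           ≡⟨ *-identityʳ q ⟩
  q                                ∎
  where open ≤-Reasoning

if-nonNeg : ∀ b {x} → 0ℚ ≤ x → 0ℚ ≤ (if b then x else 0ℚ)
if-nonNeg true 0≤x = 0≤x
if-nonNeg false _ = ≤-refl

if-≤ : ∀ b {x y} → 0ℚ ≤ y → (T b → x ≤ y) → (if b then x else 0ℚ) ≤ y
if-≤ true _ x≤y = x≤y tt
if-≤ false 0≤y _ = 0≤y

if-mono-≤ : ∀ b {x y} → (T b → x ≤ y) → (if b then x else 0ℚ) ≤ (if b then y else 0ℚ)
if-mono-≤ true x≤y = x≤y tt
if-mono-≤ false _ = ≤-refl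

if-mono-< : ∀ {b x y} → T b → x < y → (if b then x else 0ℚ) < (if b then y else 0ℚ)
if-mono-< {true} _ x<y = x<y

if-≤-if : ∀ b c {x} → 0ℚ ≤ x → (T b → T c) → (if b then x else 0ℚ) ≤ (if c then x else 0ℚ)
if-≤-if false c 0≤x _ = if-nonNeg c 0≤x
if-≤-if true c 0≤x b⇒c with c | b⇒c tt
... | true | _ = ≤-refl

sumF≡sum : ∀ {k} (f : Fin k → ℚ) → sumF f ≡ sum f
sumF≡sum {zero} f = refl
sumF≡sum {suc k} f = cong (λ s → f F.zero + s) (sumF≡sum (f ∘ F.suc))

sumF-cong : ∀ {k} {f g : Fin k → ℚ} → (∀ x → f x ≡ g x) → sumF f ≡ sumF g
sumF-cong {zero} h = refl
sumF-cong {suc k} h = cong₂ _+_ (h F.zero) (sumF-cong (h ∘ F.suc))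

sumF-zero : ∀ k → sumF {k} (λ _ → 0ℚ) ≡ 0ℚ
sumF-zero k = ≡-trans (sumF≡sum {k} (λ _ → 0ℚ)) (sum-replicate-zero k)

sumF-+ : ∀ {k} (f g : Fin k → ℚ) → sumF (λ x → f x + g x) ≡ sumF f + sumF g
sumF-+ f g = begin
  sumF (λ x → f x + g x)  ≡⟨ sumF≡sum (λ x → f x + g x) ⟩
  sum (λ x → f x + g x)   ≡⟨ ∑-distrib-+ f g ⟩
  sum f + sum g           ≡⟨ ≡-sym (cong₂ _+_ (sumF≡sum f) (sumF≡sum g)) ⟩
  sumF f + sumF g         ∎
  where open ≡-Reasoning

sumF-comm : ∀ {k l} (f : Fin k → Fin l → ℚ) →
            sumF (λ x → sumF (f x)) ≡ sumF (λ y → sumF (λ x → f x y))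
sumF-comm f = begin
  sumF (λ x → sumF (f x))          ≡⟨ sumF≡sum (λ x → sumF (f x)) ⟩
  sum (λ x → sumF (f x))           ≡⟨ sum-cong-≗ (λ x → sumF≡sum (f x)) ⟩
  sum (λ x → sum (f x))            ≡⟨ ∑-comm f ⟩
  sum (λ y → sum (λ x → f x y))    ≡⟨ ≡-sym (sum-cong-≗ (λ y → sumF≡sum (λ x → f x y))) ⟩
  sum (λ y → sumF (λ x → f x y))   ≡⟨ ≡-sym (sumF≡sum (λ y → sumF (λ x → f x y))) ⟩
  sumF (λ y → sumF (λ x → f x y))  ∎
  where open ≡-Reasoning

sumF-mono-≤ : ∀ {k} {f g : Fin k → ℚ} → (∀ x → f x ≤ g x) → sumF f ≤ sumF g
sumF-mono-≤ {zero} h = ≤-refl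
sumF-mono-≤ {suc k} h = +-mono-≤ (h F.zero) (sumF-mono-≤ (h ∘ F.suc))

sumF-mono-< : ∀ {k} {f g : Fin k → ℚ} → (∀ x → f x ≤ g x) → ∀ x → f x < g x → sumF f < sumF g
sumF-mono-< {suc k} h F.zero lt = +-mono-<-≤ lt (sumF-mono-≤ (h ∘ F.suc))
sumF-mono-< {suc k} h (F.suc x) lt = +-mono-≤-< (h F.zero) (sumF-mono-< (h ∘ F.suc) x lt)

sumF-point : ∀ {k} {f : Fin k → ℚ} j → (∀ x → x ≢ j → f x ≡ 0ℚ) → sumF f ≡ f j
sumF-point {suc k} {f} F.zero h = begin
  f F.zero + sumF (f ∘ F.suc)  ≡⟨ cong (λ s → f F.zero + s) (sumF-cong (λ x → h (F.suc x) λ ())) ⟩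
  f F.zero + sumF {k} (λ _ → 0ℚ)  ≡⟨ cong (λ s → f F.zero + s) (sumF-zero k) ⟩
  f F.zero + 0ℚ                ≡⟨ +-identityʳ _ ⟩
  f F.zero                     ∎
  where open ≡-Reasoning
sumF-point {suc k} {f} (F.suc j) h = begin
  f F.zero + sumF (f ∘ F.suc)
    ≡⟨ cong₂ _+_ (h F.zero λ ()) (sumF-point j λ x x≢j → h (F.suc x) (x≢j ∘ suc-injective)) ⟩
  0ℚ + f (F.suc j)             ≡⟨ +-identityˡ _ ⟩
  f (F.suc j)                  ∎
  where open ≡-Reasoning

⌊≟⌋-refl : ∀ {k} (x : Fin k) → ⌊ x F.≟ x ⌋ ≡ true
⌊≟⌋-refl x = cong ⌊_⌋ (≡-≟-identity F._≟_ refl)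

⌊≟⌋-≢ : ∀ {k} {x y : Fin k} → x ≢ y → ⌊ x F.≟ y ⌋ ≡ false
⌊≟⌋-≢ x≢y = cong ⌊_⌋ (≢-≟-identity F._≟_ x≢y)

sumF-δ : ∀ {k} (j : Fin k) (g : Fin k → ℚ) → sumF (λ x → if ⌊ j F.≟ x ⌋ then g x else 0ℚ) ≡ g j
sumF-δ j g = ≡-trans
  (sumF-point j (λ x x≢j → cong (λ b → if b then g x else 0ℚ) (⌊≟⌋-≢ (x≢j ∘ ≡-sym))))
  (cong (λ b → if b then g j else 0ℚ) (⌊≟⌋-refl j))

sumF-override : ∀ {k} (j : Fin k) (g f : Fin k → ℚ) → f j ≡ 0ℚ →
                sumF (λ x → if ⌊ x F.≟ j ⌋ then g x else f x) ≡ sumF f + g j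
sumF-override j g f fj≡0 = begin
  sumF (λ x → if ⌊ x F.≟ j ⌋ then g x else f x)          ≡⟨ sumF-cong split ⟩
  sumF (λ x → f x + (if ⌊ x F.≟ j ⌋ then g x else 0ℚ))   ≡⟨ sumF-+ f _ ⟩
  sumF f + sumF (λ x → if ⌊ x F.≟ j ⌋ then g x else 0ℚ)  ≡⟨ cong (λ s → sumF f + s) (sumF-point j off) ⟩
  sumF f + (if ⌊ j F.≟ j ⌋ then g j else 0ℚ)
    ≡⟨ cong (λ b → sumF f + (if b then g j else 0ℚ)) (⌊≟⌋-refl j) ⟩
  sumF f + g j                                            ∎
  where
  open ≡-Reasoning
  split : ∀ x → (if ⌊ x F.≟ j ⌋ then g x else f x) ≡ f x + (if ⌊ x F.≟ j ⌋ then g x else 0ℚ)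
  split x with x F.≟ j
  ... | yes refl = ≡-sym (≡-trans (cong (_+ g x) fj≡0) (+-identityˡ (g x)))
  ... | no _ = ≡-sym (+-identityʳ (f x))
  off : ∀ x → x ≢ j → (if ⌊ x F.≟ j ⌋ then g x else 0ℚ) ≡ 0ℚ
  off x x≢j = cong (λ b → if b then g x else 0ℚ) (⌊≟⌋-≢ x≢j)

f≤sumF : ∀ {k} {f : Fin k → ℚ} → (∀ x → 0ℚ ≤ f x) → ∀ x → f x ≤ sumF f
f≤sumF {f = f} h x =
  subst (_≤ sumF f) (sumF-δ x f) (sumF-mono-≤ (λ y → if-≤ ⌊ x F.≟ y ⌋ (h y) (λ _ → ≤-refl)))

maxF-nonNeg : ∀ {k} (f : Fin k → ℚ) → 0ℚ ≤ maxF f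
maxF-nonNeg {zero} f = ≤-refl
maxF-nonNeg {suc k} f = ≤-trans (maxF-nonNeg (f ∘ F.suc)) (p≤q⊔p (f F.zero) _)

f≤maxF : ∀ {k} (f : Fin k → ℚ) x → f x ≤ maxF f
f≤maxF {suc k} f F.zero = p≤p⊔q _ _
f≤maxF {suc k} f (F.suc x) = ≤-trans (f≤maxF (f ∘ F.suc) x) (p≤q⊔p (f F.zero) _)

maxF-lub : ∀ {k} {f : Fin k → ℚ} {b} → 0ℚ ≤ b → (∀ x → f x ≤ b) → maxF f ≤ b
maxF-lub {zero} 0≤b h = 0≤b
maxF-lub {suc k} 0≤b h = ⊔-lub (h F.zero) (maxF-lub 0≤b (h ∘ F.suc))

-- Stated with _<ᵇ_ so that inInterval (suc l) (suc r) (suc x) reduces to inInterval l r x.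
inInterval : ℕ → ℕ → ℕ → Bool
inInterval l r x = (l <ᵇ suc x) ∧ (x <ᵇ suc r)

inInterval-sound : ∀ {l r x} → T (inInterval l r x) → l ℕ.≤ x × x ℕ.≤ r
inInterval-sound {l} {r} {x} t with Equivalence.to T-∧ t
... | l<1+x , x<1+r = ℕ.≤-pred (ℕ.<ᵇ⇒< l (suc x) l<1+x) , ℕ.≤-pred (ℕ.<ᵇ⇒< x (suc r) x<1+r)

inInterval-complete : ∀ {l r x} → l ℕ.≤ x → x ℕ.≤ r → T (inInterval l r x)
inInterval-complete l≤x x≤r = Equivalence.from T-∧ (ℕ.<⇒<ᵇ (s≤s l≤x) , ℕ.<⇒<ᵇ (s≤s x≤r))

sumF-inInterval-const : ∀ {k} l r c → r ℕ.< k → l ℕ.≤ r →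
  sumF {k} (λ i → if inInterval l r (toℕ i) then c else 0ℚ) ≡ [1+ r ∸ l ] * c
sumF-inInterval-const {suc k} zero zero c _ _ = begin
  c + sumF {k} (λ _ → 0ℚ)  ≡⟨ cong (λ s → c + s) (sumF-zero k) ⟩
  c + 0ℚ                   ≡⟨ +-identityʳ c ⟩
  c                        ≡⟨ ≡-sym (*-identityˡ c) ⟩
  1ℚ * c                   ∎
  where open ≡-Reasoning
sumF-inInterval-const {suc k} zero (suc r) c (s≤s r<k) _ = begin
  c + sumF {k} (λ i → if inInterval 0 r (toℕ i) then c else 0ℚ)
    ≡⟨ cong (λ s → c + s) (sumF-inInterval-const 0 r c r<k z≤n) ⟩
  c + [1+ r ] * c            ≡⟨ cong (_+ [1+ r ] * c) (≡-sym (*-identityˡ c)) ⟩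
  1ℚ * c + [1+ r ] * c       ≡⟨ ≡-sym (*-distribʳ-+ c 1ℚ [1+ r ]) ⟩
  (1ℚ + [1+ r ]) * c         ≡⟨ cong (_* c) (≡-sym ([1+]-suc r)) ⟩
  [1+ suc r ] * c            ∎
  where open ≡-Reasoning
sumF-inInterval-const {suc k} (suc l) (suc r) c (s≤s r<k) (s≤s l≤r) =
  ≡-trans (+-identityˡ _) (sumF-inInterval-const l r c r<k l≤r)

module _ (I : RAI) where
  open RAI I

  load-update : ∀ (a : Assignment I) {j} i i' → a j ≡ nothing →
                load I (update I a j i) i' ≡ load I a i' + (if ⌊ i F.≟ i' ⌋ then p j else 0ℚ)
  load-update a {j} i i' aj≡nothing = ≡-trans
    (sumF-cong λ x → if-float (λ o → if isOn I o i' then p x else 0ℚ) ⌊ x F.≟ j ⌋)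
    (sumF-override j _ _ (cong (λ o → if isOn I o i' then p j else 0ℚ) aj≡nothing))

  load-update-same : ∀ (a : Assignment I) {j} i → a j ≡ nothing → load I (update I a j i) i ≡ load I a i + p j
  load-update-same a {j} i aj≡nothing =
    ≡-trans (load-update a i i aj≡nothing) (cong (λ b → load I a i + (if b then p j else 0ℚ)) (⌊≟⌋-refl i))

  load-update-other : ∀ (a : Assignment I) {j} {i i'} → a j ≡ nothing → i ≢ i' →
                      load I (update I a j i) i' ≡ load I a i'
  load-update-other a {j} {i} {i'} aj≡nothing i≢i' = begin
    load I (update I a j i) i'                               ≡⟨ load-update a i i' aj≡nothing ⟩
    load I a i' + (if ⌊ i F.≟ i' ⌋ then p j else 0ℚ)
      ≡⟨ cong (λ b → load I a i' + (if b then p j else 0ℚ)) (⌊≟⌋-≢ i≢i') ⟩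
    load I a i' + 0ℚ                                        ≡⟨ +-identityʳ _ ⟩
    load I a i'                                             ∎
    where open ≡-Reasoning

  placedWithin : ℕ → ℕ → Maybe (Fin m) → Bool
  placedWithin l r nothing = false
  placedWithin l r (just i) = inInterval l r (toℕ i)

  sumF-load-interval : ∀ (a : Assignment I) l r →
    sumF (λ i → if inInterval l r (toℕ i) then load I a i else 0ℚ)
      ≡ sumF (λ j → if placedWithin l r (a j) then p j else 0ℚ)
  sumF-load-interval a l r = begin
    sumF (λ i → if R i then sumF (λ j → on i j) else 0ℚ)  ≡⟨ sumF-cong (λ i → if-sum (R i) (on i)) ⟩
    sumF (λ i → sumF (λ j → if R i then on i j else 0ℚ))
      ≡⟨ sumF-comm (λ i j → if R i then on i j else 0ℚ) ⟩
    sumF (λ j → sumF (λ i → if R i then on i j else 0ℚ))  ≡⟨ sumF-cong (λ j → column (a j) (p j)) ⟩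
    sumF (λ j → if placedWithin l r (a j) then p j else 0ℚ) ∎
    where
    open ≡-Reasoning
    R : Fin m → Bool
    R i = inInterval l r (toℕ i)
    on : Fin m → Fin n → ℚ
    on i j = if isOn I (a j) i then p j else 0ℚ
    if-sum : ∀ b (f : Fin n → ℚ) → (if b then sumF f else 0ℚ) ≡ sumF (λ j → if b then f j else 0ℚ)
    if-sum true f = refl
    if-sum false f = ≡-sym (sumF-zero n)
    if-zero-swap : ∀ b c (x : ℚ) →
      (if b then (if c then x else 0ℚ) else 0ℚ) ≡ (if c then (if b then x else 0ℚ) else 0ℚ)
    if-zero-swap false false x = refl
    if-zero-swap false true x = refl
    if-zero-swap true c x = refl
    column : ∀ o x → sumF (λ i → if R i then (if isOn I o i then x else 0ℚ) else 0ℚ)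
                       ≡ (if placedWithin l r o then x else 0ℚ)
    column nothing x = ≡-trans (sumF-cong (λ i → if-zero-swap (R i) false x)) (sumF-zero m)
    column (just i₀) x = ≡-trans (sumF-cong (λ i → if-zero-swap (R i) ⌊ i₀ F.≟ i ⌋ x))
                                 (sumF-δ i₀ (λ i → if R i then x else 0ℚ))

  jobWithin : ℕ → Fin m → Fin n → Bool
  jobWithin l r j = (l ℕ.≤ᵇ toℕ (lft j)) ∧ (toℕ (rgt j) ℕ.≤ᵇ toℕ r)

  jobWithin-sound : ∀ {l r j} → T (jobWithin l r j) → l ℕ.≤ toℕ (lft j) × rgt j F.≤ r
  jobWithin-sound {l} {r} {j} t with Equivalence.to T-∧ t
  ... | l≤lft , rgt≤r = ℕ.≤ᵇ⇒≤ l _ l≤lft , ℕ.≤ᵇ⇒≤ (toℕ (rgt j)) _ rgt≤r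

  jobWithin-complete : ∀ {l r j} → l ℕ.≤ toℕ (lft j) → rgt j F.≤ r → T (jobWithin l r j)
  jobWithin-complete l≤lft rgt≤r = Equivalence.from T-∧ (ℕ.≤⇒≤ᵇ l≤lft , ℕ.≤⇒≤ᵇ rgt≤r)

  0≤pmax : 0ℚ ≤ pmax I
  0≤pmax = maxF-nonNeg p

  density≤Lbound : ∀ l r → toℕ l ℕ.≤ toℕ r → density I l r ≤ Lbound I
  density≤Lbound l r l≤r = ≤-trans density≤densities (≤-trans (f≤maxF densities l) (p≤q⊔p (pmax I) _))
    where
    densities : Fin m → ℚ
    densities l' = maxF (λ r' → if toℕ l' ℕ.≤ᵇ toℕ r' then density I l' r' else 0ℚ)
    at-r : (if toℕ l ℕ.≤ᵇ toℕ r then density I l r else 0ℚ) ≡ density I l r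
    at-r = cong (λ b → if b then density I l r else 0ℚ) (Equivalence.to T-≡ (ℕ.≤⇒≤ᵇ l≤r))
    density≤densities : density I l r ≤ densities l
    density≤densities = subst (_≤ densities l) at-r (f≤maxF _ r)

  -- p(J(l, r)) with a natural-number left end: pJ l r reduces to sizeWithin (toℕ l) r.
  sizeWithin : ℕ → Fin m → ℚ
  sizeWithin l r = sumF (λ j → if jobWithin l r j then p j else 0ℚ)

  sizeWithin≤[1+]*Lbound : ∀ l r → l ℕ.≤ toℕ r → sizeWithin l r ≤ [1+ toℕ r ∸ l ] * Lbound I
  sizeWithin≤[1+]*Lbound l r l≤r =
    subst (λ x → sizeWithin x r ≤ [1+ toℕ r ∸ x ] * Lbound I) (toℕ-fromℕ< l<m)
          (p*1/[1+d]≤q⇒p≤[1+d]*q (toℕ r ∸ toℕ l') (density≤Lbound l' r l'≤r))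
    where
    l<m : l ℕ.< m
    l<m = ℕ.≤-<-trans l≤r (toℕ<n r)
    l' : Fin m
    l' = F.fromℕ< l<m
    l'≤r : toℕ l' ℕ.≤ toℕ r
    l'≤r = subst (ℕ._≤ toℕ r) (≡-sym (toℕ-fromℕ< l<m)) l≤r

  Lbound-lub : ∀ {x} → 0ℚ ≤ x → pmax I ≤ x → (∀ l r → toℕ l ℕ.≤ toℕ r → density I l r ≤ x) →
               Lbound I ≤ x
  Lbound-lub 0≤x pmax≤x density≤x = ⊔-lub pmax≤x (maxF-lub 0≤x λ l → maxF-lub 0≤x λ r →
    if-≤ (toℕ l ℕ.≤ᵇ toℕ r) 0≤x (density≤x l r ∘ ℕ.≤ᵇ⇒≤ (toℕ l) (toℕ r)))

  0≤makespan : ∀ (s : Schedule I) → 0ℚ ≤ makespan I s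
  0≤makespan (σ , _) = maxF-nonNeg (load I (λ j → just (σ j)))

  p≤makespan : ∀ (s : Schedule I) j → p j ≤ makespan I s
  p≤makespan (σ , _) j = ≤-trans p≤load (f≤maxF (load I a) (σ j))
    where
    a : Assignment I
    a j' = just (σ j')
    p≤load : p j ≤ load I a (σ j)
    p≤load = subst (_≤ load I a (σ j)) (cong (λ b → if b then p j else 0ℚ) (⌊≟⌋-refl (σ j)))
               (f≤sumF (λ j' → if-nonNeg (isOn I (a j') (σ j)) (p≥0 j')) j)

  density≤makespan : ∀ (s : Schedule I) l r → toℕ l ℕ.≤ toℕ r → density I l r ≤ makespan I s
  density≤makespan (σ , σ-eligible) l r l≤r = p≤[1+d]*q⇒p*1/[1+d]≤q (toℕ r ∸ toℕ l) (begin
    pJ I l r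
      ≤⟨ sumF-mono-≤ (λ j → if-≤-if _ _ (p≥0 j) (within j)) ⟩
    sumF (λ j → if placedWithin (toℕ l) (toℕ r) (a j) then p j else 0ℚ)
      ≡⟨ ≡-sym (sumF-load-interval a (toℕ l) (toℕ r)) ⟩
    sumF {m} (λ i → if inInterval (toℕ l) (toℕ r) (toℕ i) then load I a i else 0ℚ)
      ≤⟨ sumF-mono-≤ (λ i → if-mono-≤ _ (λ _ → f≤maxF (load I a) i)) ⟩
    sumF {m} (λ i → if inInterval (toℕ l) (toℕ r) (toℕ i) then M else 0ℚ)
      ≡⟨ sumF-inInterval-const (toℕ l) (toℕ r) M (toℕ<n r) l≤r ⟩
    [1+ toℕ r ∸ toℕ l ] * M                                 ∎)
    where
    open ≤-Reasoning
    a : Assignment I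
    a j = just (σ j)
    M : ℚ
    M = maxF (load I a)
    within : ∀ j → T (jobWithin (toℕ l) r j) → T (inInterval (toℕ l) (toℕ r) (toℕ (σ j)))
    within j t with jobWithin-sound {toℕ l} t | σ-eligible j
    ... | l≤lft , rgt≤r | lft≤σ , σ≤rgt =
      inInterval-complete {toℕ l} (ℕ.≤-trans l≤lft lft≤σ) (ℕ.≤-trans σ≤rgt rgt≤r)

  Lbound+pmax≤2*makespan : (s : Schedule I) → Lbound I + pmax I ≤ (1ℚ + 1ℚ) * makespan I s
  Lbound+pmax≤2*makespan s = begin
    Lbound I + pmax I  ≤⟨ +-mono-≤ (Lbound-lub 0≤M pmax≤M (density≤makespan s)) pmax≤M ⟩
    M + M              ≡⟨ cong₂ _+_ (≡-sym (*-identityˡ M)) (≡-sym (*-identityˡ M)) ⟩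
    1ℚ * M + 1ℚ * M    ≡⟨ ≡-sym (*-distribʳ-+ M 1ℚ 1ℚ) ⟩
    (1ℚ + 1ℚ) * M      ∎
    where
    open ≤-Reasoning
    M : ℚ
    M = makespan I s
    0≤M : 0ℚ ≤ M
    0≤M = 0≤makespan s
    pmax≤M : pmax I ≤ M
    pmax≤M = maxF-lub 0≤M (p≤makespan s)

  Confined : Assignment I → ℕ → Fin m → Set
  Confined a l r =
    ∀ {j i} → a j ≡ just i → l ℕ.≤ toℕ i → i F.≤ r → l ℕ.≤ toℕ (lft j) × rgt j F.≤ r

  overloaded-interval-unconfined : ∀ (a : Assignment I) l r → l ℕ.≤ toℕ r →
    (∀ i → l ℕ.≤ toℕ i → i F.≤ r → Lbound I < load I a i) → ¬ Confined a l r
  overloaded-interval-unconfined a l r l≤r overloaded confined = <-irrefl refl (begin-strict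
    [1+ toℕ r ∸ l ] * Lbound I
      ≡⟨ ≡-sym (sumF-inInterval-const l (toℕ r) _ (toℕ<n r) l≤r) ⟩
    sumF {m} (λ i → if R i then Lbound I else 0ℚ)
      <⟨ sumF-mono-< (λ i → if-mono-≤ (R i) (<⇒≤ ∘ over i)) r (if-mono-< r∈R (over r r∈R)) ⟩
    sumF (λ i → if R i then load I a i else 0ℚ)
      ≡⟨ sumF-load-interval a l (toℕ r) ⟩
    sumF (λ j → if placedWithin l (toℕ r) (a j) then p j else 0ℚ)
      ≤⟨ sumF-mono-≤ (λ j → if-≤-if _ _ (p≥0 j) (within j)) ⟩
    sizeWithin l r
      ≤⟨ sizeWithin≤[1+]*Lbound l r l≤r ⟩
    [1+ toℕ r ∸ l ] * Lbound I                                       ∎)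
    where
    open ≤-Reasoning
    R : Fin m → Bool
    R i = inInterval l (toℕ r) (toℕ i)
    r∈R : T (R r)
    r∈R = inInterval-complete l≤r ℕ.≤-refl
    over : ∀ i → T (R i) → Lbound I < load I a i
    over i t = let (l≤i , i≤r) = inInterval-sound t in overloaded i l≤i i≤r
    within : ∀ j → T (placedWithin l (toℕ r) (a j)) → T (jobWithin l r j)
    within j t with a j in e
    ... | just i = let (l≤i , i≤r) = inInterval-sound t
                       (l≤lft , rgt≤r) = confined e l≤i i≤r
                   in jobWithin-complete l≤lft rgt≤r

  PlacedBy : Assignment I → Fin n → Fin m → Set
  PlacedBy a j i = ∃ λ i' → a j ≡ just i' × i' F.≤ i

  Settled : Assignment I → Fin m → Set
  Settled a i = ∀ j → Eligible I j i → PlacedBy a j i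

  placed-or-free : ∀ (a : Assignment I) j → (∃ λ i → a j ≡ just i) ⊎ a j ≡ nothing
  placed-or-free a j with a j
  ... | just i = inj₁ (i , refl)
  ... | nothing = inj₂ refl

  update-just : ∀ (a : Assignment I) j i {j' i'} → update I a j i j' ≡ just i' →
                (j' ≡ j × i' ≡ i) ⊎ a j' ≡ just i'
  update-just a j i {j'} e with j' F.≟ j
  ... | yes j'≡j = inj₁ (j'≡j , ≡-sym (just-injective e))
  ... | no _ = inj₂ e

  update-keeps : ∀ (a : Assignment I) {j} i {j' i'} → a j ≡ nothing → a j' ≡ just i' →
                 update I a j i j' ≡ just i'
  update-keeps a {j} i {j'} aj≡nothing aj'≡just with j' F.≟ j
  ... | yes refl = contradiction (≡-trans (≡-sym aj≡nothing) aj'≡just) λ ()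
  ... | no _ = aj'≡just

  placedBy-update : ∀ (a : Assignment I) {j} i {j' i'} → a j ≡ nothing →
                    PlacedBy a j' i' → PlacedBy (update I a j i) j' i'
  placedBy-update a i aj≡nothing (i'' , e , i''≤i') = i'' , update-keeps a i aj≡nothing e , i''≤i'

  record Invariant (k : ℕ) (a : Assignment I) : Set where
    field
      placed-eligible : ∀ {j i} → a j ≡ just i → Eligible I j i
      placed-early    : ∀ {j i} → a j ≡ just i → toℕ i ℕ.≤ k
      load-bounded    : ∀ i → load I a i ≤ Lbound I + pmax I
      passed          : ∀ i → toℕ i ℕ.< k → Lbound I < load I a i ⊎ Settled a i
      least-flexible  : ∀ {j i j'} → a j ≡ just i → Eligible I j' i → rgt j' F.< rgt j → PlacedBy a j' i

  invariant-start : Invariant 0 (λ _ → nothing)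
  invariant-start = record
    { placed-eligible = λ ()
    ; placed-early = λ ()
    ; load-bounded = λ _ → subst (_≤ Lbound I + pmax I) (≡-sym (sumF-zero n)) 0≤L+pmax
    ; passed = λ _ ()
    ; least-flexible = λ ()
    }
    where
    0≤L+pmax : 0ℚ ≤ Lbound I + pmax I
    0≤L+pmax = +-mono-≤ (≤-trans 0≤pmax (p≤p⊔q _ _)) 0≤pmax

  invariant-place : ∀ {a} i j → Invariant (toℕ i) a → load I a i ≤ Lbound I → Avail I a j i →
                    (∀ j' → Avail I a j' i → rgt j F.≤ rgt j') → Invariant (toℕ i) (update I a j i)
  invariant-place {a} i j inv load≤L (aj≡nothing , j-eligible) least = record
    { placed-eligible = eligible
    ; placed-early = early
    ; load-bounded = bounded
    ; passed = passed′
    ; least-flexible = least-flexible′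
    }
    where
    open Invariant inv
    keep : ∀ {j' i'} → PlacedBy a j' i' → PlacedBy (update I a j i) j' i'
    keep = placedBy-update a i aj≡nothing
    eligible : ∀ {j' i'} → update I a j i j' ≡ just i' → Eligible I j' i'
    eligible e with update-just a j i e
    ... | inj₁ (refl , refl) = j-eligible
    ... | inj₂ e′ = placed-eligible e′
    early : ∀ {j' i'} → update I a j i j' ≡ just i' → toℕ i' ℕ.≤ toℕ i
    early e with update-just a j i e
    ... | inj₁ (refl , refl) = ℕ.≤-refl
    ... | inj₂ e′ = placed-early e′
    bounded : ∀ i' → load I (update I a j i) i' ≤ Lbound I + pmax I
    bounded i' with i F.≟ i'
    ... | yes refl = subst (_≤ Lbound I + pmax I) (≡-sym (load-update-same a i aj≡nothing))
                       (+-mono-≤ load≤L (f≤maxF p j))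
    ... | no i≢i' = subst (_≤ Lbound I + pmax I) (≡-sym (load-update-other a aj≡nothing i≢i')) (load-bounded i')
    passed′ : ∀ i' → toℕ i' ℕ.< toℕ i → Lbound I < load I (update I a j i) i' ⊎ Settled (update I a j i) i'
    passed′ i' i'<i with passed i' i'<i
    ... | inj₁ over = inj₁ (subst (Lbound I <_) (≡-sym (load-update-other a aj≡nothing i≢i')) over)
      where
      i≢i' : i ≢ i'
      i≢i' refl = ℕ.<-irrefl refl i'<i
    ... | inj₂ settled = inj₂ (λ j' el → keep (settled j' el))
    least-flexible′ : ∀ {j₁ i₁ j₂} → update I a j i j₁ ≡ just i₁ → Eligible I j₂ i₁ →
                      rgt j₂ F.< rgt j₁ → PlacedBy (update I a j i) j₂ i₁
    least-flexible′ {j₂ = j₂} e el rgt< with update-just a j i e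
    ... | inj₂ e′ = keep (least-flexible e′ el rgt<)
    ... | inj₁ (refl , refl) with placed-or-free a j₂
    ...   | inj₁ (i₂ , e₂) = i₂ , update-keeps a i aj≡nothing e₂ , placed-early e₂
    ...   | inj₂ e₂ = contradiction (least j₂ (e₂ , el)) (ℕ.<⇒≱ rgt<)

  invariant-next : ∀ {a} i → Invariant (toℕ i) a → (Lbound I < load I a i ⊎ (∀ j → ¬ Avail I a j i)) →
                   Invariant (suc (toℕ i)) a
  invariant-next {a} i inv done = record
    { placed-eligible = placed-eligible
    ; placed-early = ℕ.m≤n⇒m≤1+n ∘ placed-early
    ; load-bounded = load-bounded
    ; passed = passed′
    ; least-flexible = least-flexible
    }
    where
    open Invariant inv
    settle : (∀ j → ¬ Avail I a j i) → Settled a i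
    settle none j el with placed-or-free a j
    ... | inj₁ (i' , e) = i' , e , placed-early e
    ... | inj₂ e = contradiction (e , el) (none j)
    passed′ : ∀ i' → toℕ i' ℕ.< suc (toℕ i) → Lbound I < load I a i' ⊎ Settled a i'
    passed′ i' i'<1+i with ℕ.m≤n⇒m<n∨m≡n (ℕ.s≤s⁻¹ i'<1+i)
    ... | inj₁ i'<i = passed i' i'<i
    ... | inj₂ i'≡i with toℕ-injective i'≡i
    ...   | refl = Sum.map₂ settle done

  invariant : ∀ {k a} → LFF I k a → Invariant k a
  invariant start = invariant-start
  invariant (place i j run load≤L avail least) = invariant-place i j (invariant run) load≤L avail least
  invariant (next i run done) = invariant-next i (invariant run) done

  module _ {a : Assignment I} (inv : Invariant m a) {j₀} (j₀-free : a j₀ ≡ nothing) where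
    open Invariant inv

    private
      r : Fin m
      r = rgt j₀

      Capped : Fin m → Set
      Capped i = ∀ {j} → a j ≡ just i → rgt j F.≤ r

      Good : Fin m → Set
      Good i = Lbound I < load I a i × Capped i

      GoodFrom : ℕ → Set
      GoodFrom l = ∀ i → l ℕ.≤ toℕ i → i F.≤ r → Good i

      Barrier : Fin m → Set
      Barrier i = ∀ j → Eligible I j i → rgt j F.≤ r → PlacedBy a j i

      good-or-barrier : ∀ i → Good i ⊎ Barrier i
      good-or-barrier i with passed i (toℕ<n i)
      ... | inj₂ settled = inj₂ (λ j el _ → settled j el)
      ... | inj₁ over with any? (λ j → ≡-dec F._≟_ (a j) (just i) ×-dec (r F.<? rgt j))
      ...   | yes (j , on , r<rgt) = inj₂ (λ j' el rgt'≤r → least-flexible on el (ℕ.≤-<-trans rgt'≤r r<rgt))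
      ...   | no none = inj₁ (over , λ {j} on → ℕ.≮⇒≥ (λ r<rgt → none (j , on , r<rgt)))

      j₀-unplaced : ∀ {i} → ¬ PlacedBy a j₀ i
      j₀-unplaced (_ , e , _) = contradiction (≡-trans (≡-sym j₀-free) e) λ ()

      good-r : Good r
      good-r with good-or-barrier r
      ... | inj₁ good = good
      ... | inj₂ barrier = contradiction (barrier j₀ (lft≤rgt j₀ , ℕ.≤-refl) ℕ.≤-refl) j₀-unplaced

      barrier-confines : ∀ {d} (δ : Fin m) → toℕ δ ≡ d → Barrier δ → GoodFrom (suc d) →
                         Confined a (suc d) r
      barrier-confines δ refl barrier good {j} {i} e δ<i i≤r = lft-within , rgt≤r
        where
        rgt≤r : rgt j F.≤ r
        rgt≤r = proj₂ (good i δ<i i≤r) e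
        lft-within : suc (toℕ δ) ℕ.≤ toℕ (lft j)
        lft-within with suc (toℕ δ) ℕ.≤? toℕ (lft j)
        ... | yes δ<lft = δ<lft
        ... | no δ≮lft with barrier j (lft≤δ , δ≤rgt) rgt≤r
          where
          lft≤δ = ℕ.s≤s⁻¹ (ℕ.≰⇒> δ≮lft)
          δ≤rgt = ℕ.<⇒≤ (ℕ.<-≤-trans δ<i (proj₂ (placed-eligible e)))
        ...   | i' , e' , i'≤δ with just-injective (≡-trans (≡-sym e) e')
        ...     | refl = contradiction (ℕ.≤-trans δ<i i'≤δ) (ℕ.n≮n (toℕ δ))

      unconfined : ∀ {l} → l ℕ.≤ toℕ r → GoodFrom l → ¬ Confined a l r
      unconfined {l} l≤r good =
        overloaded-interval-unconfined a l r l≤r (λ i l≤i i≤r → proj₁ (good i l≤i i≤r))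

      descend : ∀ l → l ℕ.≤ toℕ r → GoodFrom l → ⊥
      descend zero _ good = unconfined z≤n good (λ e l≤i i≤r → z≤n , proj₂ (good _ l≤i i≤r) e)
      descend (suc d) d<r good = step (good-or-barrier δ)
        where
        d<m : d ℕ.< m
        d<m = ℕ.<-≤-trans d<r (ℕ.<⇒≤ (toℕ<n r))
        δ : Fin m
        δ = F.fromℕ< d<m
        δ≡d : toℕ δ ≡ d
        δ≡d = toℕ-fromℕ< d<m
        step : Good δ ⊎ Barrier δ → ⊥
        step (inj₁ good-δ) = descend d (ℕ.<⇒≤ d<r) good′
          where
          good′ : GoodFrom d
          good′ i d≤i i≤r with ℕ.m≤n⇒m<n∨m≡n d≤i
          ... | inj₁ d<i = good i d<i i≤r
          ... | inj₂ d≡i = subst Good (toℕ-injective (≡-trans δ≡d d≡i)) good-δ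
        step (inj₂ barrier) = unconfined d<r good (barrier-confines δ δ≡d barrier good)

    unplaced-job-impossible : ⊥
    unplaced-job-impossible = descend (toℕ r) ℕ.≤-refl
      (λ i r≤i i≤r → subst Good (toℕ-injective (ℕ.≤-antisym r≤i i≤r)) good-r)

  every-job-placed : ∀ {a} → Invariant m a → ∀ j → ∃ λ i → a j ≡ just i × Eligible I j i
  every-job-placed {a} inv j with placed-or-free a j
  ... | inj₁ (i , e) = i , e , Invariant.placed-eligible inv e
  ... | inj₂ e = ⊥-elim (unplaced-job-impossible inv e)

lemma2 : (I : RAI) (a : Assignment I) → LFF I (RAI.m I) a →
    ((∀ j → ∃ λ (i : Fin (RAI.m I)) → (a j ≡ just i) × Eligible I j i)
    × (∀ i → load I a i ≤ Lbound I + pmax I))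
    × (∀ (v : ℚ) → IsOPT I v → Lbound I + pmax I ≤ (1ℚ + 1ℚ) * v)
lemma2 I a run =
  (every-job-placed I inv , Invariant.load-bounded inv) ,
  λ v ((s , makespan≡v) , _) →
    subst (λ x → Lbound I + pmax I ≤ (1ℚ + 1ℚ) * x) makespan≡v (Lbound+pmax≤2*makespan I s)
  where
  inv : Invariant I (RAI.m I) a
  inv = invariant I run
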